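{- For every $n\ge1$ there is a bijection $\sigma\mapsto\sigma'$ from $\mathcal{X}_{2n}$ onto $\mathcal{R}_{2n}$ with $\mathsf{drop}(\sigma')=\mathsf{des}(\sigma)$.
   Context: For $\sigma=\sigma_1\cdots\sigma_m\in\mathfrak{S}_m$, a descent is $i\in[m-1]$ with $\sigma_i>\sigma_{i+1}$, with descent pair $(\sigma_i,\sigma_{i+1})$; $\mathsf{des}(\sigma)$ is the number of descents. A drop is a pair $(i,\sigma_i)$ with $i>\sigma_i$ ($i$ the drop top, $\sigma_i$ the drop bottom); $\mathsf{drop}(\sigma)$ is the number of drops. $\mathcal{X}_{2n}$ is the set of $\sigma\in\mathfrak{S}_{2n}$ all of whose descent pairs $(\sigma_i,\sigma_{i+1})$ have $\sigma_i$ even and $\sigma_{i+1}$ odd. $\mathcal{R}_{2n}$ is the set of $\sigma\in\mathfrak{S}_{2n}$ all of whose drops $(i,\sigma_i)$ have $i$ even and $\sigma_i$ odd. -}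

module Defs where

open import Data.Nat using (ℕ; zero; suc; _+_; _*_; _<_; _>_)
open import Data.Nat.Properties using (_<?_)
open import Data.Nat.Divisibility using (_∣_)
open import Relation.Nullary using (¬_)
open import Data.Fin using (Fin; toℕ; inject₁) renaming (suc to fsuc)
open import Data.List using (List; length; filter)
open import Data.List using (allFin)
open import Data.Product using (Σ; _×_; _,_; proj₁; ∃)
open import Function.Definitions using (Bijective)
open import Relation.Binary.PropositionalEquality using (_≡_)

-- Permutations of [m] = {1,…,m}, represented on Fin m: index i : Fin m stands
-- for the integer toℕ i + 1 (positions and values alike).
Perm : ℕ → Set
Perm m = Σ (Fin m → Fin m) (Bijective _≡_ _≡_)

Even : ℕ → Set
Even k = 2 ∣ k

Odd : ℕ → Set
Odd k = ¬ (2 ∣ k)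

val : {m : ℕ} → Fin m → ℕ
val i = suc (toℕ i)

desList : {k : ℕ} → Perm (suc k) → List (Fin k)
desList {k} (σ , _) = filter (λ j → val (σ (fsuc j)) <? val (σ (inject₁ j))) (allFin k)

des : {m : ℕ} → Perm m → ℕ
des {zero} σ = 0
des {suc k} σ = length (desList σ)

dropList : {m : ℕ} → Perm m → List (Fin m)
dropList {m} (σ , _) = filter (λ i → val (σ i) <? val i) (allFin m)

drop : {m : ℕ} → Perm m → ℕ
drop σ = length (dropList σ)

IsX : (m : ℕ) → Perm m → Set
IsX zero σ = Data.Unit.⊤ where import Data.Unit
IsX (suc k) (σ , b) = (j : Fin k) → val (σ (fsuc j)) < val (σ (inject₁ j)) →
  Even (val (σ (inject₁ j))) × Odd (val (σ (fsuc j)))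

IsR : (m : ℕ) → Perm m → Set
IsR m (σ , _) = (i : Fin m) → val (σ i) < val i → Even (val i) × Odd (val (σ i))

𝒳 : ℕ → Set
𝒳 m = Σ (Perm m) (IsX m)

ℛ : ℕ → Set
ℛ m = Σ (Perm m) (IsR m)

_≈P_ : {m : ℕ} → Perm m → Perm m → Set
_≈P_ {m} (σ , _) (τ , _) = (i : Fin m) → σ i ≡ τ i

IsBijectionXR : (m : ℕ) → (𝒳 m → ℛ m) → Set
IsBijectionXR m F =
  ((x y : 𝒳 m) → proj₁ (F x) ≈P proj₁ (F y) → proj₁ x ≈P proj₁ y) ×
  ((r : ℛ m) → Σ (𝒳 m) λ x → proj₁ (F x) ≈P proj₁ r)

-- The bijection sends σ to the permutation τ with τ (σ i) = min (σ (i + 1)) (max (σ 1) … (σ i))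
-- for i < m and τ (σ m) = m. Then τ (σ i) < σ i exactly when i is a descent, and then
-- τ (σ i) = σ (i + 1): the drops of τ are precisely the descent pairs of σ, so drop τ = des σ and
-- the parity conditions defining 𝒳 and ℛ match. Since max (σ 1) … (σ i) is the largest value not
-- among σ (i + 1) … σ m, σ can be read off τ from right to left; so σ ↦ τ is an injection of the
-- finite set 𝔖_m into itself, hence a bijection, and it restricts to a bijection 𝒳 → ℛ.

module Submission where

open import Defs
open import Data.Nat using (ℕ; suc; _*_)
open import Data.Product using (Σ; _×_; proj₁)
open import Relation.Binary.PropositionalEquality using (_≡_)

open import Level using (0ℓ)
open import Data.Nat using (zero; _+_; _^_; z≤n; s≤s; s<s; s<s⁻¹) renaming (_≤_ to _≤ℕ_; _<_ to _<ℕ_)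
import Data.Nat.Properties as ℕ
open import Data.Bool using (true; false; if_then_else_)
open import Data.Fin using (Fin; zero; suc; toℕ; inject₁; fromℕ; punchOut; _≤_; _<_; funToFin; finToFun; combine)
open import Data.Fin.Properties
  using (any?; all?; _≟_; _≤?_; _<?_; ≤-totalOrder; ≤-antisym; <-irrefl; <-cmp; ≤∧≢⇒<; ≤fromℕ; suc-injective;
         ≤̄⇒inject₁<; toℕ-inject₁; inject₁-injective; fromℕ≢inject₁; injective⇒≤; punchOut-injective;
         finToFun-funToFin; funToFin-finToFin)
open import Data.Fin.Induction using (>-wellFounded)
open import Data.Fin.Relation.Unary.Top using (view; ‵fromℕ; ‵inject₁; view-fromℕ; view-inject₁)
open import Data.Fin.Permutation using (Permutation′; _⟨$⟩ˡ_; inverseˡ; inverseʳ)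
open import Data.List using (length; filter; tabulate)
open import Data.Product using (_,_; proj₂; ∃)
open import Data.Sum using (_⊎_; inj₁; inj₂)
open import Function using (_∘_; id; _⇔_; mk⇔; Injective; Bijective; StrictlySurjective)
open import Function.Bundles using (mk⤖)
open import Function.Properties.Bijection using (⤖⇒↔)
open import Function.Consequences.Propositional using (strictlySurjective⇒surjective; surjective⇒strictlySurjective)
import Induction.WellFounded as WF
open import Relation.Binary.Definitions using (tri<; tri≈; tri>)
open import Relation.Binary.PropositionalEquality using (refl; sym; trans; cong; cong₂; subst; _≢_; _≗_; module ≡-Reasoning)
open import Relation.Nullary using (¬_; Dec; yes; no; does; contradiction)
open import Relation.Nullary.Decidable using (does-⇔; dec-false; _→-dec_)
open import Relation.Unary using (Pred; Decidable)
import Algebra.Construct.NaturalChoice.Max as Max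
import Algebra.Construct.NaturalChoice.Min as Min
open import Algebra.Properties.CommutativeMonoid.Sum ℕ.+-0-commutativeMonoid
  using (sum; sum-permute; sum-init-last; sum-cong-≗)

module FinMax {n : ℕ} = Max (≤-totalOrder n)
module FinMin {n : ℕ} = Min (≤-totalOrder n)
open FinMax using (_⊔_; x≤x⊔y; x≤y⊔x; ⊔-sel)
open FinMin using (_⊓_; ⊓-sel; x⊓y≈x⇒x≤y; x⊓y≈y⇒y≤x)

private
  variable
    k m n : ℕ

injective⇒strictlySurjective : (f : Fin n → Fin n) → Injective _≡_ _≡_ f → StrictlySurjective _≡_ f
injective⇒strictlySurjective {suc n} f f-inj y with any? (λ x → f x ≟ y)
... | yes hit = hit
... | no miss = contradiction (injective⇒≤ punchOut∘f-injective) ℕ.1+n≰n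
  where
  f≢y : ∀ x → y ≢ f x
  f≢y x eq = miss (x , sym eq)
  punchOut∘f-injective : Injective _≡_ _≡_ (λ x → punchOut (f≢y x))
  punchOut∘f-injective eq = f-inj (punchOut-injective (f≢y _) (f≢y _) eq)

inject₁<suc : (j : Fin k) → inject₁ j < suc j
inject₁<suc j = ≤̄⇒inject₁< ℕ.≤-refl

inject₁<⇒suc≤ : {j : Fin k} {b : Fin (suc k)} → inject₁ j < b → suc j ≤ b
inject₁<⇒suc≤ {j = j} {b} = subst (λ t → suc t ≤ℕ toℕ b) (toℕ-inject₁ j)

inject₁-or-fromℕ : (i : Fin (suc k)) → (∃ λ j → i ≡ inject₁ j) ⊎ i ≡ fromℕ k
inject₁-or-fromℕ i with view i
... | ‵fromℕ = inj₂ refl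
... | ‵inject₁ j = inj₁ (j , refl)

-- Extended by the identity off the image of the code, Φ becomes an injective endomap of Fin n.
module _ {A : Set} (_≈_ : A → A → Set) (code : A → Fin n)
         (code-cong : ∀ {a b} → a ≈ b → code a ≡ code b)
         (code-injective : ∀ {a b} → code a ≡ code b → a ≈ b)
         (inImage? : ∀ c → Dec (∃ λ a → code a ≡ c)) where

  module _ (Φ : A → A) (Φ-injective : ∀ {a b} → Φ a ≈ Φ b → a ≈ b) where
    private
      extend : (c : Fin n) → Dec (∃ λ a → code a ≡ c) → Fin n
      extend c (yes (a , _)) = code (Φ a)
      extend c (no _) = c

      extend-injective : ∀ {c c'} d d' → extend c d ≡ extend c' d' → c ≡ c'
      extend-injective (yes (a , refl)) (yes (a' , refl)) eq = code-cong (Φ-injective (code-injective eq))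
      extend-injective (yes (a , _)) (no miss) eq = contradiction (Φ a , eq) miss
      extend-injective (no miss) (yes (a' , _)) eq = contradiction (Φ a' , sym eq) miss
      extend-injective (no _) (no _) eq = eq

      preimage : ∀ {b} c d → extend c d ≡ code b → ∃ λ a → Φ a ≈ b
      preimage c (yes (a , _)) eq = a , code-injective eq
      preimage {b} c (no miss) eq = contradiction (b , sym eq) miss

    coded-injective⇒surjective : ∀ b → ∃ λ a → Φ a ≈ b
    coded-injective⇒surjective b
      with c , hc≡ ← injective⇒strictlySurjective (λ c → extend c (inImage? c))
                       (extend-injective (inImage? _) (inImage? _)) (code b)
      = preimage c (inImage? c) hc≡

fromInjective : (f : Fin m → Fin m) → Injective _≡_ _≡_ f → Perm m
fromInjective f f-inj = f , f-inj , strictlySurjective⇒surjective (injective⇒strictlySurjective f f-inj)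

asPermutation : Perm m → Permutation′ m
asPermutation (_ , σ-bij) = ⤖⇒↔ (mk⤖ σ-bij)

funToFin-cong : {f g : Fin m → Fin n} → f ≗ g → funToFin f ≡ funToFin g
funToFin-cong {zero} f≗g = refl
funToFin-cong {suc m} f≗g = cong₂ combine (f≗g zero) (funToFin-cong (f≗g ∘ suc))

funToFin-injective : {f g : Fin m → Fin n} → funToFin f ≡ funToFin g → f ≗ g
funToFin-injective {f = f} {g} eq x = begin
  f x                       ≡⟨ sym (finToFun-funToFin f x) ⟩
  finToFun (funToFin f) x   ≡⟨ cong (λ c → finToFun c x) eq ⟩
  finToFun (funToFin g) x   ≡⟨ finToFun-funToFin g x ⟩
  g x                       ∎
  where open ≡-Reasoning

permCode : Perm m → Fin (m ^ m)
permCode (σ , _) = funToFin σ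

injective? : (f : Fin m → Fin n) → Dec (∀ x y → f x ≡ f y → x ≡ y)
injective? f = all? λ x → all? λ y → (f x ≟ f y) →-dec (x ≟ y)

permCode? : (c : Fin (m ^ m)) → Dec (∃ λ s → permCode s ≡ c)
permCode? {m} c with injective? (finToFun {m} {m} c)
... | yes c-inj = yes (fromInjective (finToFun c) (c-inj _ _) , funToFin-finToFin {m} {m} c)
... | no c-noninj = no λ where
  ((σ , σ-inj , _) , refl) → c-noninj λ x y eq →
    σ-inj (trans (sym (finToFun-funToFin σ x)) (trans eq (finToFun-funToFin σ y)))

perm-injective⇒surjective : (Φ : Perm m → Perm m) → (∀ {s t} → Φ s ≈P Φ t → s ≈P t) →
                            ∀ r → ∃ λ s → Φ s ≈P r
perm-injective⇒surjective {m} =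
  coded-injective⇒surjective _≈P_ permCode (funToFin-cong {m} {m}) (funToFin-injective {m} {m}) permCode?

indicator : {P : Set} → Dec P → ℕ
indicator P? = if does P? then 1 else 0

indicator-⇔ : {P Q : Set} → P ⇔ Q → (P? : Dec P) (Q? : Dec Q) → indicator P? ≡ indicator Q?
indicator-⇔ P⇔Q P? Q? = cong (λ b → if b then 1 else 0) (does-⇔ P⇔Q P? Q?)

indicator-¬ : {P : Set} → ¬ P → (P? : Dec P) → indicator P? ≡ 0
indicator-¬ ¬p P? = cong (λ b → if b then 1 else 0) (dec-false P? ¬p)

length-filter-tabulate : {A : Set} {P : Pred A 0ℓ} (P? : Decidable P) (f : Fin n → A) →
                         length (filter P? (tabulate f)) ≡ sum (λ i → indicator (P? (f i)))
length-filter-tabulate {zero} P? f = refl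
length-filter-tabulate {suc n} P? f with does (P? (f zero))
... | true = cong suc (length-filter-tabulate P? (f ∘ suc))
... | false = length-filter-tabulate P? (f ∘ suc)

indicator-val< : (a b : Fin n) → indicator (val a ℕ.<? val b) ≡ indicator (a <? b)
indicator-val< a b = indicator-⇔ (mk⇔ s<s⁻¹ s<s) (val a ℕ.<? val b) (a <? b)

prefixMax : (Fin (suc k) → Fin n) → Fin (suc k) → Fin n
prefixMax f zero = f zero
prefixMax {suc k} f (suc i) = f zero ⊔ prefixMax (f ∘ suc) i

≤-prefixMax : (f : Fin (suc k) → Fin n) {i j : Fin (suc k)} → j ≤ i → f j ≤ prefixMax f i
≤-prefixMax f {zero} {zero} _ = ℕ.≤-refl
≤-prefixMax {suc k} f {suc i} {zero} _ = x≤x⊔y (f zero) (prefixMax (f ∘ suc) i)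
≤-prefixMax {suc k} f {suc i} {suc j} (s≤s j≤i) =
  ℕ.≤-trans (≤-prefixMax (f ∘ suc) j≤i) (x≤y⊔x (f zero) (prefixMax (f ∘ suc) i))

prefixMax-attained : (f : Fin (suc k) → Fin n) (i : Fin (suc k)) → ∃ λ j → j ≤ i × prefixMax f i ≡ f j
prefixMax-attained f zero = zero , z≤n , refl
prefixMax-attained {suc k} f (suc i) with ⊔-sel (f zero) (prefixMax (f ∘ suc) i)
... | inj₁ max≡f0 = zero , z≤n , max≡f0
... | inj₂ max≡rest with j , j≤i , eq ← prefixMax-attained (f ∘ suc) i = suc j , s≤s j≤i , trans max≡rest eq

prefixMax-mono : (f : Fin (suc k) → Fin n) {i i' : Fin (suc k)} → i ≤ i' → prefixMax f i ≤ prefixMax f i'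
prefixMax-mono f {i} i≤i' with j , j≤i , eq ← prefixMax-attained f i
  rewrite eq = ≤-prefixMax f (ℕ.≤-trans j≤i i≤i')

prefixMax-≤-agreeingSuffix : (f g : Fin (suc k) → Fin n) → Injective _≡_ _≡_ f → StrictlySurjective _≡_ g →
                             (i : Fin (suc k)) → (∀ {j} → i < j → f j ≡ g j) → prefixMax f i ≤ prefixMax g i
prefixMax-≤-agreeingSuffix f g f-inj g-surj i agree
  with a , a≤i , max≡fa ← prefixMax-attained f i
  with b , gb≡fa ← g-surj (f a)
  with b ≤? i
... | yes b≤i = subst (_≤ prefixMax g i) (trans gb≡fa (sym max≡fa)) (≤-prefixMax g b≤i)
... | no b≰i = contradiction (subst (_≤ i) (sym b≡a) a≤i) b≰i
  where
  b≡a : b ≡ a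
  b≡a = f-inj (trans (agree (ℕ.≰⇒> b≰i)) gb≡fa)

prefixMax-agreeingSuffix : (f g : Fin (suc k) → Fin n) → Bijective _≡_ _≡_ f → Bijective _≡_ _≡_ g →
                           (i : Fin (suc k)) → (∀ {j} → i < j → f j ≡ g j) → prefixMax f i ≡ prefixMax g i
prefixMax-agreeingSuffix f g (f-inj , f-surj) (g-inj , g-surj) i agree = ≤-antisym
  (prefixMax-≤-agreeingSuffix f g f-inj (surjective⇒strictlySurjective g-surj) i agree)
  (prefixMax-≤-agreeingSuffix g f g-inj (surjective⇒strictlySurjective f-surj) i (sym ∘ agree))

-- ρ i = min (f (i + 1)) (max (f 0) … (f i)) on positions 0 … k, with the missing f (k + 1) read as +∞.
cappedNext : (Fin (suc k) → Fin n) → Fin (suc k) → Fin n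
cappedNext {k} f i with view i
... | ‵fromℕ = prefixMax f (fromℕ k)
... | ‵inject₁ j = f (suc j) ⊓ prefixMax f (inject₁ j)

cappedNext-fromℕ : (f : Fin (suc k) → Fin n) → cappedNext f (fromℕ k) ≡ prefixMax f (fromℕ k)
cappedNext-fromℕ {k} f rewrite view-fromℕ k = refl

cappedNext-inject₁ : (f : Fin (suc k) → Fin n) (j : Fin k) →
                     cappedNext f (inject₁ j) ≡ f (suc j) ⊓ prefixMax f (inject₁ j)
cappedNext-inject₁ f j rewrite view-inject₁ j = refl

module _ (f : Fin (suc k) → Fin n) (f-inj : Injective _≡_ _≡_ f) where

  next≢prefixMax : (j : Fin k) → f (suc j) ≢ prefixMax f (inject₁ j)
  next≢prefixMax j next≡max with c , c≤j , max≡fc ← prefixMax-attained f (inject₁ j) =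
    ℕ.<⇒≱ (inject₁<suc j) (subst (_≤ inject₁ j) (sym (f-inj (trans next≡max max≡fc))) c≤j)

  cappedNext-inject₁-cases : (j : Fin k) →
    (cappedNext f (inject₁ j) ≡ f (suc j) × f (suc j) < prefixMax f (inject₁ j)) ⊎
    (cappedNext f (inject₁ j) ≡ prefixMax f (inject₁ j) × prefixMax f (inject₁ j) < f (suc j))
  cappedNext-inject₁-cases j with ⊓-sel (f (suc j)) (prefixMax f (inject₁ j))
  ... | inj₁ min≡next = inj₁ (trans (cappedNext-inject₁ f j) min≡next ,
                              ≤∧≢⇒< (x⊓y≈x⇒x≤y min≡next) (next≢prefixMax j))
  ... | inj₂ min≡max = inj₂ (trans (cappedNext-inject₁ f j) min≡max ,
                             ≤∧≢⇒< (x⊓y≈y⇒y≤x min≡max) (next≢prefixMax j ∘ sym))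

  cappedNext-cases : (i : Fin (suc k)) →
    (∃ λ j → i ≡ inject₁ j × cappedNext f i ≡ f (suc j)) ⊎ cappedNext f i ≡ prefixMax f i
  cappedNext-cases i with inject₁-or-fromℕ i
  ... | inj₂ refl = inj₂ (cappedNext-fromℕ f)
  ... | inj₁ (j , refl) with cappedNext-inject₁-cases j
  ...   | inj₁ (ρ≡next , _) = inj₁ (j , refl , ρ≡next)
  ...   | inj₂ (ρ≡max , _) = inj₂ ρ≡max

  descent⇒cappedNext≡next : (j : Fin k) → f (suc j) < f (inject₁ j) → cappedNext f (inject₁ j) ≡ f (suc j)
  descent⇒cappedNext≡next j descent with cappedNext-inject₁-cases j
  ... | inj₁ (ρ≡next , _) = ρ≡next
  ... | inj₂ (_ , max<next) =
    contradiction (≤-prefixMax f ℕ.≤-refl) (ℕ.<⇒≱ (ℕ.<-trans max<next descent))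

  cappedNext<⇒descent : (i : Fin (suc k)) → cappedNext f i < f i →
                        ∃ λ j → i ≡ inject₁ j × cappedNext f i ≡ f (suc j)
  cappedNext<⇒descent i ρ<f with cappedNext-cases i
  ... | inj₁ at-descent = at-descent
  ... | inj₂ ρ≡max = contradiction (≤-prefixMax f ℕ.≤-refl) (ℕ.<⇒≱ (subst (_< f i) ρ≡max ρ<f))

  cappedNext<⇔descent : (j : Fin k) → cappedNext f (inject₁ j) < f (inject₁ j) ⇔ f (suc j) < f (inject₁ j)
  cappedNext<⇔descent j = mk⇔ to from
    where
    to : cappedNext f (inject₁ j) < f (inject₁ j) → f (suc j) < f (inject₁ j)
    to ρ<f with j' , j≡j' , ρ≡next ← cappedNext<⇒descent (inject₁ j) ρ<f
      with refl ← inject₁-injective j≡j' = subst (_< f (inject₁ j)) ρ≡next ρ<f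
    from : f (suc j) < f (inject₁ j) → cappedNext f (inject₁ j) < f (inject₁ j)
    from descent = subst (_< f (inject₁ j)) (sym (descent⇒cappedNext≡next j descent)) descent

  cappedNext≮-fromℕ : ¬ (cappedNext f (fromℕ k) < f (fromℕ k))
  cappedNext≮-fromℕ ρ<f with _ , fromℕ≡inject₁ , _ ← cappedNext<⇒descent (fromℕ k) ρ<f =
    fromℕ≢inject₁ fromℕ≡inject₁

  -- ρ a is either σ (a + 1) below the running maximum or the running maximum below σ (a + 1); for
  -- a < b each combination contradicts injectivity of f or monotonicity of the running maximum.
  cappedNext-separates : {a b : Fin (suc k)} → a < b → cappedNext f a ≢ cappedNext f b
  cappedNext-separates {a} {b} a<b ρa≡ρb with inject₁-or-fromℕ a
  ... | inj₂ refl = ℕ.<⇒≱ a<b (≤fromℕ b)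
  ... | inj₁ (j , refl) with cappedNext-inject₁-cases j | cappedNext-cases b
  ... | inj₁ (ρa≡next , _) | inj₁ (j' , refl , ρb≡next') =
    <-irrefl (cong inject₁ (suc-injective (f-inj (trans (sym ρa≡next) (trans ρa≡ρb ρb≡next'))))) a<b
  ... | inj₁ (ρa≡next , next<max) | inj₂ ρb≡max =
    ℕ.<⇒≱ next<max (subst (prefixMax f (inject₁ j) ≤_) (trans (sym ρb≡max) (trans (sym ρa≡ρb) ρa≡next))
                           (prefixMax-mono f (ℕ.<⇒≤ a<b)))
  ... | inj₂ (ρa≡max , _) | inj₁ (j' , refl , ρb≡next')
    with c , c≤a , max≡fc ← prefixMax-attained f (inject₁ j) =
    ℕ.<⇒≱ (inject₁<suc j') (subst (_≤ inject₁ j') c≡suc (ℕ.≤-trans c≤a (ℕ.<⇒≤ a<b)))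
    where
    c≡suc : c ≡ suc j'
    c≡suc = f-inj (trans (sym max≡fc) (trans (sym ρa≡max) (trans ρa≡ρb ρb≡next')))
  ... | inj₂ (ρa≡max , max<next) | inj₂ ρb≡max =
    ℕ.<⇒≱ max<next (subst (f (suc j) ≤_) (trans (sym ρb≡max) (trans (sym ρa≡ρb) ρa≡max))
                           (≤-prefixMax f (inject₁<⇒suc≤ a<b)))

  cappedNext-injective : Injective _≡_ _≡_ (cappedNext f)
  cappedNext-injective {a} {b} ρa≡ρb with <-cmp a b
  ... | tri< a<b _ _ = contradiction ρa≡ρb (cappedNext-separates a<b)
  ... | tri≈ _ a≡b _ = a≡b
  ... | tri> _ _ b<a = contradiction (sym ρa≡ρb) (cappedNext-separates b<a)

cappedNext-agreeingSuffix : (f g : Fin (suc k) → Fin n) → Bijective _≡_ _≡_ f → Bijective _≡_ _≡_ g →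
                            (i : Fin (suc k)) → (∀ {j} → i < j → f j ≡ g j) → cappedNext f i ≡ cappedNext g i
cappedNext-agreeingSuffix f g f-bij g-bij i agree with inject₁-or-fromℕ i
... | inj₂ refl = begin
  cappedNext f (fromℕ _)   ≡⟨ cappedNext-fromℕ f ⟩
  prefixMax f (fromℕ _)    ≡⟨ prefixMax-agreeingSuffix f g f-bij g-bij _ agree ⟩
  prefixMax g (fromℕ _)    ≡⟨ cappedNext-fromℕ g ⟨
  cappedNext g (fromℕ _)   ∎
  where open ≡-Reasoning
... | inj₁ (j , refl) = begin
  cappedNext f (inject₁ j)                   ≡⟨ cappedNext-inject₁ f j ⟩
  f (suc j) ⊓ prefixMax f (inject₁ j)        ≡⟨ cong₂ _⊓_ (agree (inject₁<suc j))
                                                         (prefixMax-agreeingSuffix f g f-bij g-bij _ agree) ⟩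
  g (suc j) ⊓ prefixMax g (inject₁ j)        ≡⟨ cappedNext-inject₁ g j ⟨
  cappedNext g (inject₁ j)                   ∎
  where open ≡-Reasoning

descentsToDrops : Perm (suc k) → Perm (suc k)
descentsToDrops s@(σ , σ-inj , _) = fromInjective (cappedNext σ ∘ (π ⟨$⟩ˡ_)) τ-injective
  where
  π = asPermutation s
  τ-injective : Injective _≡_ _≡_ (cappedNext σ ∘ (π ⟨$⟩ˡ_))
  τ-injective {x} {y} τx≡τy = begin
    x                ≡⟨ inverseʳ π ⟨
    σ (π ⟨$⟩ˡ x)     ≡⟨ cong σ (cappedNext-injective σ σ-inj τx≡τy) ⟩
    σ (π ⟨$⟩ˡ y)     ≡⟨ inverseʳ π ⟩
    y                ∎
    where open ≡-Reasoning

module _ (s : Perm (suc k)) where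
  private
    σ = proj₁ s
    σ-inj = proj₁ (proj₂ s)
    π = asPermutation s
    τ = proj₁ (descentsToDrops s)

  descentsToDrops-∘ : (i : Fin (suc k)) → τ (σ i) ≡ cappedNext σ i
  descentsToDrops-∘ i = cong (cappedNext σ) (inverseˡ π)

  descentsToDrops-descent : (j : Fin k) → σ (suc j) < σ (inject₁ j) → τ (σ (inject₁ j)) ≡ σ (suc j)
  descentsToDrops-descent j descent =
    trans (descentsToDrops-∘ (inject₁ j)) (descent⇒cappedNext≡next σ σ-inj j descent)

  descentsToDrops-drop : (p : Fin (suc k)) → τ p < p → ∃ λ j → p ≡ σ (inject₁ j) × τ p ≡ σ (suc j)
  descentsToDrops-drop p τp<p
    with j , i≡j , ρ≡next ← cappedNext<⇒descent σ σ-inj (π ⟨$⟩ˡ p) (subst (τ p <_) (sym (inverseʳ π)) τp<p)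
    = j , trans (sym (inverseʳ π)) (cong σ i≡j) , ρ≡next

  drop-descentsToDrops : drop (descentsToDrops s) ≡ des s
  drop-descentsToDrops = begin
    drop (descentsToDrops s)
      ≡⟨ length-filter-tabulate (λ p → val (τ p) ℕ.<? val p) id ⟩
    sum (λ p → indicator (val (τ p) ℕ.<? val p))
      ≡⟨ sum-permute (λ p → indicator (val (τ p) ℕ.<? val p)) π ⟩
    sum (λ i → indicator (val (τ (σ i)) ℕ.<? val (σ i)))
      ≡⟨ sum-cong-≗ (λ i → trans (indicator-val< (τ (σ i)) (σ i))
                                 (cong (λ x → indicator (x <? σ i)) (descentsToDrops-∘ i))) ⟩
    sum (λ i → indicator (cappedNext σ i <? σ i))
      ≡⟨ sum-init-last (λ i → indicator (cappedNext σ i <? σ i)) ⟩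
    sum (λ j → indicator (cappedNext σ (inject₁ j) <? σ (inject₁ j))) + indicator (cappedNext σ (fromℕ k) <? σ (fromℕ k))
      ≡⟨ cong₂ _+_ (sum-cong-≗ (λ j → indicator-⇔ (cappedNext<⇔descent σ σ-inj j)
                                   (cappedNext σ (inject₁ j) <? σ (inject₁ j)) (σ (suc j) <? σ (inject₁ j))))
                   (indicator-¬ (cappedNext≮-fromℕ σ σ-inj) (cappedNext σ (fromℕ k) <? σ (fromℕ k))) ⟩
    sum (λ j → indicator (σ (suc j) <? σ (inject₁ j))) + 0
      ≡⟨ ℕ.+-identityʳ _ ⟩
    sum (λ j → indicator (σ (suc j) <? σ (inject₁ j)))
      ≡⟨ sum-cong-≗ (λ j → indicator-val< (σ (suc j)) (σ (inject₁ j))) ⟨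
    sum (λ j → indicator (val (σ (suc j)) ℕ.<? val (σ (inject₁ j))))
      ≡⟨ length-filter-tabulate (λ j → val (σ (suc j)) ℕ.<? val (σ (inject₁ j))) id ⟨
    des s
      ∎
    where open ≡-Reasoning

  IsX⇒IsR-descentsToDrops : IsX (suc k) s → IsR (suc k) (descentsToDrops s)
  IsX⇒IsR-descentsToDrops isX p τp<p with descentsToDrops-drop p (s<s⁻¹ τp<p)
  ... | j , refl , τp≡next rewrite τp≡next = isX j τp<p

  IsR-descentsToDrops⇒IsX : IsR (suc k) (descentsToDrops s) → IsX (suc k) s
  IsR-descentsToDrops⇒IsX isR j descent =
    subst (λ x → Even (val (σ (inject₁ j))) × Odd (val x)) τσ≡next
          (isR (σ (inject₁ j)) (subst (λ x → val x <ℕ val (σ (inject₁ j))) (sym τσ≡next) descent))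
    where
    τσ≡next : τ (σ (inject₁ j)) ≡ σ (suc j)
    τσ≡next = descentsToDrops-descent j (s<s⁻¹ descent)

-- σ is recovered from τ right to left: ρ i depends only on σ beyond i, and σ i = τ⁻¹ (ρ i).
descentsToDrops-injective : (s t : Perm (suc k)) → descentsToDrops s ≈P descentsToDrops t → s ≈P t
descentsToDrops-injective s@(σ , σ-bij) t@(σ' , σ'-bij) τ≈τ' =
  WF.All.wfRec >-wellFounded 0ℓ (λ i → σ i ≡ σ' i) agreeAt
  where
  τ = proj₁ (descentsToDrops s)
  τ-injective = proj₁ (proj₂ (descentsToDrops s))
  agreeAt : ∀ i → (∀ {j} → i < j → σ j ≡ σ' j) → σ i ≡ σ' i
  agreeAt i agree = τ-injective (begin
    τ (σ i)                           ≡⟨ descentsToDrops-∘ s i ⟩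
    cappedNext σ i                    ≡⟨ cappedNext-agreeingSuffix σ σ' σ-bij σ'-bij i agree ⟩
    cappedNext σ' i                   ≡⟨ descentsToDrops-∘ t i ⟨
    proj₁ (descentsToDrops t) (σ' i)  ≡⟨ τ≈τ' (σ' i) ⟨
    τ (σ' i)                          ∎)
    where open ≡-Reasoning

descentsToDrops-surjective : (r : Perm (suc k)) → ∃ λ s → descentsToDrops s ≈P r
descentsToDrops-surjective = perm-injective⇒surjective descentsToDrops (λ {s} {t} → descentsToDrops-injective s t)

IsR-resp-≈P : (s t : Perm m) → s ≈P t → IsR m s → IsR m t
IsR-resp-≈P _ _ s≈t isR i ti<i rewrite sym (s≈t i) = isR i ti<i

proposition2p11 : (n : ℕ) → 1 Data.Nat.≤ n →
    Σ (𝒳 (2 * n) → ℛ (2 * n)) λ F →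
    IsBijectionXR (2 * n) F × ((x : 𝒳 (2 * n)) → drop (proj₁ (F x)) ≡ des (proj₁ x))
proposition2p11 (suc n) _ = F , (F-injective , F-surjective) , λ (s , _) → drop-descentsToDrops s
  where
  F : 𝒳 (2 * suc n) → ℛ (2 * suc n)
  F (s , isX) = descentsToDrops s , IsX⇒IsR-descentsToDrops s isX

  F-injective : ∀ x y → proj₁ (F x) ≈P proj₁ (F y) → proj₁ x ≈P proj₁ y
  F-injective (s , _) (t , _) = descentsToDrops-injective s t

  F-surjective : ∀ r → Σ (𝒳 (2 * suc n)) λ x → proj₁ (F x) ≈P proj₁ r
  F-surjective (r , isR) with s , τ≈r ← descentsToDrops-surjective r =
    (s , IsR-descentsToDrops⇒IsX s (IsR-resp-≈P r (descentsToDrops s) (λ i → sym (τ≈r i)) isR)) , τ≈r
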